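{- Let $H=(V,E,\ell)$ be an edge-colored hypergraph with colors $[k]$ and let $b\ge0$ be an integer. Let $\{x_v^c,x_e,z_v\}$ be an optimal solution of the linear program $$\min\sum_{e\in E}x_e\quad\text{s.t.}\quad \sum_{c=1}^k x_v^c\ge k-1\ \ \forall v\in V;\qquad x_v^c-z_v\le x_e\ \ \forall c\in[k],\ \forall e\in E\text{ with }\ell(e)=c,\ \forall v\in e;\qquad \sum_{v\in V}z_v\le b;\qquad x_v^c,x_e,z_v\in[0,1].$$ For $\varepsilon\in(0,\tfrac12)$, let $\lambda$ be the coloring in which node $v$ is deleted (i.e., $\lambda(v)=[k]$) if $z_v\ge\varepsilon$, and otherwise $v$ is given color $c$ if and only if $x_v^c<\tfrac12$. Then $\lambda$ is a bicriteria $\left(\frac{2}{1-2\varepsilon},\frac1\varepsilon\right)$-approximation for Robust ECC: its number of mistakes is at most $\frac{2}{1-2\varepsilon}$ times the optimal number of mistakes for Robust ECC with budget $b$, each non-deleted node receives at most one color, and at most $b/\varepsilon$ nodes are deleted.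
   Context: An edge-colored hypergraph $H=(V,E,\ell)$ consists of a finite node set $V$, a finite collection $E$ of hyperedges (subsets of $V$), and a labeling $\ell:E\to[k]$. A coloring is a map $\lambda:V\to 2^{[k]}$; it makes a mistake at $e\in E$ if some $v\in e$ has $\ell(e)\notin\lambda(v)$. Robust ECC with budget $b\ge0$: minimize the number of hyperedges at which $\lambda$ makes a mistake over colorings in which at most $b$ nodes $v$ have $\lambda(v)=[k]$ (deleted nodes) and every other node has exactly one color. A bicriteria $(\alpha,\beta)$-approximation is a coloring whose number of mistakes is within a factor $\alpha$ of the optimum and which violates the budget constraint by a factor at most $\beta$.
   Formalization: The optimal solution of the linear program and the parameter ε take rational values, with optimality measured only against rational feasible solutions. -}

module Defs where

open import Data.Nat as ℕ using (ℕ; zero; suc)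
open import Data.Bool using (Bool; true; false; _∧_; not; if_then_else_)
import Data.Bool.Properties as BoolP
open import Data.Fin using (Fin; zero; suc)
open import Data.Fin.Subset using (Subset; ⊤; ∣_∣; _∈_; _∉_)
open import Data.Vec using (Vec; lookup; tabulate)
open import Data.Vec.Properties using (≡-dec)
open import Data.Integer using (+_)
open import Data.Rational using (ℚ; 0ℚ; 1ℚ; _+_; _-_; _*_; _≤_; _<_; _/_; ½)
open import Data.Rational.Properties using (_≤?_; _<?_)
open import Relation.Nullary.Decidable using (⌊_⌋)
open import Relation.Binary.PropositionalEquality using (_≡_)
open import Data.Product using (_×_; Σ; ∃)
open import Data.Sum using (_⊎_)

-- An edge-colored hypergraph with node set Fin n, hyperedges indexed by Fin m
-- (a finite collection, repetitions allowed), colors Fin k.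
record Hypergraph (n m k : ℕ) : Set where
  field
    edge  : Fin m → Subset n
    label : Fin m → Fin k

open Hypergraph public

Coloring : ℕ → ℕ → Set
Coloring n k = Fin n → Subset k

anyFin : ∀ {n} → (Fin n → Bool) → Bool
anyFin {zero}  p = false
anyFin {suc n} p = p zero Data.Bool.∨ anyFin (λ i → p (suc i))

mistakeAt : ∀ {n m k} → Hypergraph n m k → Coloring n k → Fin m → Bool
mistakeAt H col e = anyFin (λ v → lookup (edge H e) v ∧ not (lookup (col v) (label H e)))

mistakes : ∀ {n m k} → Hypergraph n m k → Coloring n k → ℕ
mistakes {m = m} H col = ∣ tabulate {n = m} (mistakeAt H col) ∣

isDeleted : ∀ {n k} → Coloring n k → Fin n → Bool
isDeleted col v = ⌊ ≡-dec BoolP._≟_ (col v) ⊤ ⌋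

numDeleted : ∀ {n k} → Coloring n k → ℕ
numDeleted {n} col = ∣ tabulate {n = n} (isDeleted col) ∣

RobustFeasible : ∀ {n k} → ℕ → Coloring n k → Set
RobustFeasible b col =
  (∀ v → col v ≡ ⊤ ⊎ ∣ col v ∣ ≡ 1) × (numDeleted col ℕ.≤ b)

ℕtoℚ : ℕ → ℚ
ℕtoℚ a = + a / 1

sumℚ : ∀ {n} → (Fin n → ℚ) → ℚ
sumℚ {zero}  f = 0ℚ
sumℚ {suc n} f = f zero + sumℚ (λ i → f (suc i))

record LPSol (n m k : ℕ) : Set where
  field
    xv : Fin n → Fin k → ℚ
    xe : Fin m → ℚ
    z  : Fin n → ℚ

open LPSol public

InUnit : ℚ → Set
InUnit q = (0ℚ ≤ q) × (q ≤ 1ℚ)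

LPFeasible : ∀ {n m k} → Hypergraph n m k → ℕ → LPSol n m k → Set
LPFeasible {n} {m} {k} H b s =
    (∀ v → ℕtoℚ k - 1ℚ ≤ sumℚ (λ c → xv s v c))
  × (∀ (e : Fin m) (v : Fin n) → v ∈ edge H e →
       xv s v (label H e) - z s v ≤ xe s e)
  × (sumℚ (z s) ≤ ℕtoℚ b)
  × (∀ v c → InUnit (xv s v c))
  × (∀ e → InUnit (xe s e))
  × (∀ v → InUnit (z s v))

LPObjective : ∀ {n m k} → LPSol n m k → ℚ
LPObjective s = sumℚ (xe s)

LPOptimal : ∀ {n m k} → Hypergraph n m k → ℕ → LPSol n m k → Set
LPOptimal H b s =
  LPFeasible H b s × (∀ s' → LPFeasible H b s' → LPObjective s ≤ LPObjective s')

rounding : ∀ {n m k} → LPSol n m k → ℚ → Coloring n k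
rounding {k = k} s ε v =
  if ⌊ ε ≤? z s v ⌋ then ⊤
  else tabulate {n = k} (λ c → ⌊ xv s v c <? ½ ⌋)

roundDeleted : ∀ {n m k} → LPSol n m k → ℚ → Fin n → Bool
roundDeleted s ε v = ⌊ ε ≤? z s v ⌋

numRoundDeleted : ∀ {n m k} → LPSol n m k → ℚ → ℕ
numRoundDeleted {n} s ε = ∣ tabulate {n = n} (roundDeleted s ε) ∣

{-# OPTIONS --safe #-}
-- Every robust colouring μ induces an integral LP solution whose objective is the number of
-- mistakes of μ, so the LP optimum is a lower bound on every robust colouring. If the rounding
-- errs at e, some v ∈ e has z_v < ε and x_v^{ℓ(e)} ≥ ½, so the edge constraint gives x_e ≥ ½ − ε;
-- summing, (1 − 2ε)·mistakes ≤ 2·Σ x_e. Deletions are paid for by Σ z_v ≤ b at rate ε each, and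
-- two colours with x_v^c < ½ would make Σ_c x_v^c < k − 1.
module Submission where

open import Defs
open import Data.Nat as ℕ using (ℕ; zero; suc)
open import Data.Fin using (Fin; zero; suc)
open import Data.Fin.Subset using (Subset; ⊤; ∣_∣; _∈_)
open import Data.Bool using (Bool; true; false; not; _∧_)
open import Data.Vec using (lookup; tabulate)
open import Data.Vec.Properties using (lookup∘tabulate; tabulate∘lookup; lookup-replicate; []=⇒lookup; lookup⇒[]=; ≡-dec)
open import Data.Integer as ℤ using (+_)
open import Data.Rational using (ℚ; 0ℚ; 1ℚ; _+_; _-_; _*_; _≤_; _<_; ½; mkℚ; _/_; *≤*)
open import Data.Rational.Properties
open import Data.Rational.Solver using (module +-*-Solver)
import Data.Nat.Coprimality as Coprime
import Data.Integer.Properties as ℤ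
import Data.Nat.Properties as ℕ
import Data.Bool.Properties as Bool
open import Data.Product using (_×_; _,_; ∃; proj₁; proj₂; uncurry)
open import Data.Sum using (inj₁; inj₂)
open import Relation.Nullary using (yes; no; contradiction)
open import Relation.Nullary.Decidable using (⌊_⌋)
open import Relation.Binary.PropositionalEquality

open +-*-Solver

ℕtoℚ-mkℚ : ∀ a → ℕtoℚ a ≡ mkℚ (+ a) 0 (Coprime.sym (Coprime.1-coprimeTo a))
ℕtoℚ-mkℚ a = normalize-coprime (Coprime.sym (Coprime.1-coprimeTo a))

ℕtoℚ-suc : ∀ a → ℕtoℚ (suc a) ≡ 1ℚ + ℕtoℚ a
ℕtoℚ-suc a rewrite ℕtoℚ-mkℚ a =
  cong (_/ 1) (cong (λ i → + 1 ℤ.+ i) (sym (ℤ.*-identityʳ (+ a))))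

ℕtoℚ-mono-≤ : ∀ {a b} → a ℕ.≤ b → ℕtoℚ a ≤ ℕtoℚ b
ℕtoℚ-mono-≤ {a} {b} a≤b rewrite ℕtoℚ-mkℚ a | ℕtoℚ-mkℚ b =
  *≤* (subst₂ ℤ._≤_ (sym (ℤ.*-identityʳ (+ a))) (sym (ℤ.*-identityʳ (+ b))) (ℤ.+≤+ a≤b))

0≤1 : 0ℚ ≤ 1ℚ
0≤1 = nonNegative⁻¹ 1ℚ

p-1≤p : ∀ p → p - 1ℚ ≤ p
p-1≤p p = subst (p - 1ℚ ≤_) (+-identityʳ p) (+-monoʳ-≤ p (neg-antimono-≤ 0≤1))

indicator : Bool → ℚ → ℚ
indicator true  w = w
indicator false w = 0ℚ

indicator-unit : ∀ d → InUnit (indicator d 1ℚ)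
indicator-unit true  = 0≤1 , ≤-refl
indicator-unit false = ≤-refl , 0≤1

indicator-not : ∀ d → indicator (not d) 1ℚ + indicator d 1ℚ ≡ 1ℚ
indicator-not true  = refl
indicator-not false = refl

sumℚ-cong : ∀ {n} {f g : Fin n → ℚ} → (∀ i → f i ≡ g i) → sumℚ f ≡ sumℚ g
sumℚ-cong {zero}  f≡g = refl
sumℚ-cong {suc n} f≡g = cong₂ _+_ (f≡g zero) (sumℚ-cong (λ i → f≡g (suc i)))

sumℚ-mono-≤ : ∀ {n} {f g : Fin n → ℚ} → (∀ i → f i ≤ g i) → sumℚ f ≤ sumℚ g
sumℚ-mono-≤ {zero}  f≤g = ≤-refl
sumℚ-mono-≤ {suc n} f≤g = +-mono-≤ (f≤g zero) (sumℚ-mono-≤ (λ i → f≤g (suc i)))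

sumℚ-mono-< : ∀ {n} {f g : Fin n → ℚ} → (∀ i → f i ≤ g i) → ∀ j → f j < g j → sumℚ f < sumℚ g
sumℚ-mono-< {suc n} f≤g zero    fj<gj = +-mono-<-≤ fj<gj (sumℚ-mono-≤ (λ i → f≤g (suc i)))
sumℚ-mono-< {suc n} f≤g (suc j) fj<gj = +-mono-≤-< (f≤g zero) (sumℚ-mono-< (λ i → f≤g (suc i)) j fj<gj)

sumℚ-+ : ∀ {n} (f g : Fin n → ℚ) → sumℚ (λ i → f i + g i) ≡ sumℚ f + sumℚ g
sumℚ-+ {zero}  f g = refl
sumℚ-+ {suc n} f g rewrite sumℚ-+ (λ i → f (suc i)) (λ i → g (suc i)) =
  solve 4 (λ a b c d → (a :+ b) :+ (c :+ d) := (a :+ c) :+ (b :+ d)) refl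
    (f zero) (g zero) (sumℚ (λ i → f (suc i))) (sumℚ (λ i → g (suc i)))

sumℚ-const-1 : ∀ n → sumℚ {n} (λ _ → 1ℚ) ≡ ℕtoℚ n
sumℚ-const-1 zero = refl
sumℚ-const-1 (suc n) rewrite sumℚ-const-1 n = sym (ℕtoℚ-suc n)

sumℚ-indicator : ∀ {n} (p : Fin n → Bool) w → sumℚ (λ i → indicator (p i) w) ≡ w * ℕtoℚ ∣ tabulate p ∣
sumℚ-indicator {zero}  p w = sym (*-zeroʳ w)
sumℚ-indicator {suc n} p w with p zero
... | true rewrite sumℚ-indicator (λ i → p (suc i)) w | ℕtoℚ-suc ∣ tabulate (λ i → p (suc i)) ∣ =
  solve 2 (λ w c → w :+ w :* c := w :* (con 1ℚ :+ c)) refl w (ℕtoℚ ∣ tabulate (λ i → p (suc i)) ∣)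
... | false rewrite sumℚ-indicator (λ i → p (suc i)) w = +-identityˡ _

count>0⇒witness : ∀ {n} (p : Fin n → Bool) → 1 ℕ.≤ ∣ tabulate p ∣ → ∃ λ i → p i ≡ true
count>0⇒witness {suc n} p 1≤∣p∣ with p zero in p0
... | true  = zero , p0
... | false with count>0⇒witness (λ i → p (suc i)) 1≤∣p∣
...   | i , pi = suc i , pi

anyFin⁺ : ∀ {n} (p : Fin n → Bool) v → p v ≡ true → anyFin p ≡ true
anyFin⁺ p zero    pv rewrite pv = refl
anyFin⁺ p (suc v) pv with p zero
... | true  = refl
... | false = anyFin⁺ (λ i → p (suc i)) v pv

anyFin⁻ : ∀ {n} (p : Fin n → Bool) → anyFin p ≡ true → ∃ λ v → p v ≡ true
anyFin⁻ {suc n} p any with p zero in p0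
... | true  = zero , p0
... | false with anyFin⁻ (λ i → p (suc i)) any
...   | v , pv = suc v , pv

mistakeAt⁺ : ∀ {n m k} (H : Hypergraph n m k) (col : Coloring n k) e v → v ∈ edge H e →
             lookup (col v) (label H e) ≡ false → mistakeAt H col e ≡ true
mistakeAt⁺ H col e v v∈e miss =
  anyFin⁺ _ v (cong₂ (λ a b → a ∧ not b) ([]=⇒lookup v∈e) miss)

mistakeAt⁻ : ∀ {n m k} (H : Hypergraph n m k) (col : Coloring n k) e → mistakeAt H col e ≡ true →
             ∃ λ v → v ∈ edge H e × lookup (col v) (label H e) ≡ false
mistakeAt⁻ H col e mistake with anyFin⁻ _ mistake
... | v , _ with lookup (edge H e) v in v∈e | lookup (col v) (label H e) in miss
...   | true | false = v , lookup⇒[]= v (edge H e) v∈e , miss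

-- Raising every coordinate below ½ by ½ keeps it ≤ 1 and leaves it < 1, so two such
-- coordinates would give k − 1 + 1 ≤ Σ f + ½·cnt < k.
atMostOne-below-½ : ∀ {k} (f : Fin k → ℚ) → ℕtoℚ k - 1ℚ ≤ sumℚ f → (∀ c → f c ≤ 1ℚ) →
                    ∣ tabulate (λ c → ⌊ f c <? ½ ⌋) ∣ ℕ.≤ 1
atMostOne-below-½ {k} f lower upper = ℕ.≮⇒≥ λ 1<cnt →
  <-irrefl refl (≤-<-trans (k≤ 1<cnt) (uncurry <k (count>0⇒witness small (ℕ.<⇒≤ 1<cnt))))
  where
  small : Fin k → Bool
  small c = ⌊ f c <? ½ ⌋
  cnt : ℕ
  cnt = ∣ tabulate small ∣
  bumped≤1 : ∀ c → f c + indicator (small c) ½ ≤ 1ℚ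
  bumped≤1 c with f c <? ½
  ... | yes fc<½ = <⇒≤ (+-monoˡ-< ½ fc<½)
  ... | no  _    = subst (_≤ 1ℚ) (sym (+-identityʳ (f c))) (upper c)
  bumped<1 : ∀ j → small j ≡ true → f j + indicator (small j) ½ < 1ℚ
  bumped<1 j _ with f j <? ½
  bumped<1 j _  | yes fj<½ = +-monoˡ-< ½ fj<½
  bumped<1 j () | no _
  <k : ∀ j → small j ≡ true → sumℚ f + ½ * ℕtoℚ cnt < ℕtoℚ k
  <k j smallj = subst₂ _<_ (trans (sumℚ-+ f (λ c → indicator (small c) ½)) (cong (λ t → sumℚ f + t) (sumℚ-indicator small ½)))
                (sumℚ-const-1 k) (sumℚ-mono-< bumped≤1 j (bumped<1 j smallj))
  k≤ : 1 ℕ.< cnt → ℕtoℚ k ≤ sumℚ f + ½ * ℕtoℚ cnt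
  k≤ 1<cnt = subst (_≤ sumℚ f + ½ * ℕtoℚ cnt) (solve 1 (λ a → (a :- con 1ℚ) :+ con 1ℚ := a) refl (ℕtoℚ k))
               (+-mono-≤ lower (*-monoˡ-≤-nonNeg ½ (ℕtoℚ-mono-≤ 1<cnt)))

-- x_v^c of the integral solution of a colouring, for a node with deletion flag d and colour set S.
nodeVar : ∀ {k} → Bool → Subset k → Fin k → ℚ
nodeVar true  S c = 1ℚ
nodeVar false S c = indicator (not (lookup S c)) 1ℚ

nodeVar-unit : ∀ {k} d (S : Subset k) c → InUnit (nodeVar d S c)
nodeVar-unit true  S c = 0≤1 , ≤-refl
nodeVar-unit false S c = indicator-unit (not (lookup S c))

nodeVar-sum : ∀ {k} d (S : Subset k) → (d ≡ false → ∣ S ∣ ≡ 1) → ℕtoℚ k - 1ℚ ≤ sumℚ (nodeVar d S)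
nodeVar-sum {k} true  S _ rewrite sumℚ-const-1 k = p-1≤p (ℕtoℚ k)
nodeVar-sum {k} false S ∣S∣≡1 = ≤-reflexive (begin
  ℕtoℚ k - 1ℚ                                     ≡⟨ cong (_- 1ℚ) (sym sum+1≡k) ⟩
  (sumℚ (nodeVar false S) + 1ℚ) - 1ℚ             ≡⟨ solve 1 (λ a → (a :+ con 1ℚ) :- con 1ℚ := a) refl _ ⟩
  sumℚ (nodeVar false S)                          ∎)
  where
  open ≡-Reasoning
  sum+1≡k : sumℚ (nodeVar false S) + 1ℚ ≡ ℕtoℚ k
  sum+1≡k = begin
    sumℚ (nodeVar false S) + 1ℚ
      ≡⟨ cong (λ t → sumℚ (nodeVar false S) + ℕtoℚ t) (sym (trans (cong ∣_∣ (tabulate∘lookup S)) (∣S∣≡1 refl))) ⟩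
    sumℚ (nodeVar false S) + ℕtoℚ ∣ tabulate (lookup S) ∣
      ≡⟨ cong (λ t → sumℚ (nodeVar false S) + t) (trans (sym (*-identityˡ _)) (sym (sumℚ-indicator (lookup S) 1ℚ))) ⟩
    sumℚ (nodeVar false S) + sumℚ (λ c → indicator (lookup S c) 1ℚ)
      ≡⟨ sym (sumℚ-+ (nodeVar false S) _) ⟩
    sumℚ (λ c → nodeVar false S c + indicator (lookup S c) 1ℚ)
      ≡⟨ sumℚ-cong (λ c → indicator-not (lookup S c)) ⟩
    sumℚ {k} (λ _ → 1ℚ)
      ≡⟨ sumℚ-const-1 k ⟩
    ℕtoℚ k ∎

nodeVar-edge : ∀ {k} d (S : Subset k) c mistake → (d ≡ false → lookup S c ≡ false → mistake ≡ true) →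
               nodeVar d S c - indicator d 1ℚ ≤ indicator mistake 1ℚ
nodeVar-edge true  S c mistake _ = proj₁ (indicator-unit mistake)
nodeVar-edge false S c mistake forced with lookup S c
... | true  = proj₁ (indicator-unit mistake)
... | false rewrite forced refl refl = ≤-refl

isDeleted-⊤ : ∀ {n k} (μ : Coloring n k) v → μ v ≡ ⊤ → isDeleted μ v ≡ true
isDeleted-⊤ μ v μv≡⊤ with ≡-dec Bool._≟_ (μ v) ⊤
... | yes _    = refl
... | no μv≢⊤ = contradiction μv≡⊤ μv≢⊤

colouringSolution : ∀ {n m k} → Hypergraph n m k → Coloring n k → LPSol n m k
colouringSolution H μ = record
  { xv = λ v → nodeVar (isDeleted μ v) (μ v)
  ; xe = λ e → indicator (mistakeAt H μ e) 1ℚ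
  ; z  = λ v → indicator (isDeleted μ v) 1ℚ
  }

colouringSolution-objective : ∀ {n m k} (H : Hypergraph n m k) μ →
                              LPObjective (colouringSolution H μ) ≡ ℕtoℚ (mistakes H μ)
colouringSolution-objective H μ = trans (sumℚ-indicator (mistakeAt H μ) 1ℚ) (*-identityˡ _)

colouringSolution-feasible : ∀ {n m k} (H : Hypergraph n m k) b μ → RobustFeasible b μ →
                             LPFeasible H b (colouringSolution H μ)
colouringSolution-feasible H b μ (deletedOrSingleton , budget) =
    (λ v → nodeVar-sum (isDeleted μ v) (μ v) (kept⇒singleton v))
  , (λ e v v∈e → nodeVar-edge (isDeleted μ v) (μ v) (label H e) (mistakeAt H μ e)
                   (λ _ → mistakeAt⁺ H μ e v v∈e))
  , subst (_≤ ℕtoℚ b) (trans (sym (*-identityˡ _)) (sym (sumℚ-indicator (isDeleted μ) 1ℚ)))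
      (ℕtoℚ-mono-≤ budget)
  , (λ v → nodeVar-unit (isDeleted μ v) (μ v))
  , (λ e → indicator-unit (mistakeAt H μ e))
  , (λ v → indicator-unit (isDeleted μ v))
  where
  kept⇒singleton : ∀ v → isDeleted μ v ≡ false → ∣ μ v ∣ ≡ 1
  kept⇒singleton v kept with deletedOrSingleton v
  ... | inj₂ ∣μv∣≡1 = ∣μv∣≡1
  ... | inj₁ μv≡⊤ = contradiction (trans (sym kept) (isDeleted-⊤ μ v μv≡⊤)) λ ()

LPOptimal⇒≤mistakes : ∀ {n m k} (H : Hypergraph n m k) b s μ → LPOptimal H b s → RobustFeasible b μ →
                      LPObjective s ≤ ℕtoℚ (mistakes H μ)
LPOptimal⇒≤mistakes H b s μ (_ , optimal) μ-feasible =
  subst (LPObjective s ≤_) (colouringSolution-objective H μ)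
    (optimal (colouringSolution H μ) (colouringSolution-feasible H b μ μ-feasible))

rounding-omits⇒ : ∀ {n m k} (s : LPSol n m k) ε v c → lookup (rounding s ε v) c ≡ false →
                  z s v < ε × ½ ≤ xv s v c
rounding-omits⇒ s ε v c omits with ε ≤? z s v
... | yes _ rewrite lookup-replicate c true = contradiction omits λ ()
... | no ε≰z rewrite lookup∘tabulate (λ c → ⌊ xv s v c <? ½ ⌋) c with xv s v c <? ½
...   | yes _   = contradiction omits λ ()
...   | no x≮½ = ≰⇒> ε≰z , ≮⇒≥ x≮½

rounding-mistake⇒ : ∀ {n m k} (H : Hypergraph n m k) b s ε e → LPFeasible H b s →
                    mistakeAt H (rounding s ε) e ≡ true → ½ - ε ≤ xe s e
rounding-mistake⇒ H b s ε e (_ , edgeConstraint , _) mistake with mistakeAt⁻ H (rounding s ε) e mistake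
... | v , v∈e , omits with rounding-omits⇒ s ε v (label H e) omits
...   | z<ε , ½≤x = ≤-trans (+-mono-≤ ½≤x (neg-antimono-≤ (<⇒≤ z<ε))) (edgeConstraint e v v∈e)

rounding-mistakes≤ : ∀ {n m k} (H : Hypergraph n m k) b s ε → LPFeasible H b s →
                     (1ℚ - (ε + ε)) * ℕtoℚ (mistakes H (rounding s ε)) ≤ (1ℚ + 1ℚ) * LPObjective s
rounding-mistakes≤ H b s ε feasible@(_ , _ , _ , _ , xe-unit , _) = begin
  (1ℚ - (ε + ε)) * ℕtoℚ (mistakes H (rounding s ε))          ≡⟨ sym (sumℚ-indicator (mistakeAt H (rounding s ε)) _) ⟩
  sumℚ (λ e → indicator (mistakeAt H (rounding s ε) e) (1ℚ - (ε + ε))) ≤⟨ sumℚ-mono-≤ charge≤ ⟩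
  sumℚ (λ e → xe s e + xe s e)                                 ≡⟨ sumℚ-+ (xe s) (xe s) ⟩
  LPObjective s + LPObjective s                               ≡⟨ solve 1 (λ a → a :+ a := (con 1ℚ :+ con 1ℚ) :* a) refl (LPObjective s) ⟩
  (1ℚ + 1ℚ) * LPObjective s                                   ∎
  where
  open ≤-Reasoning
  charge≤ : ∀ e → indicator (mistakeAt H (rounding s ε) e) (1ℚ - (ε + ε)) ≤ xe s e + xe s e
  charge≤ e with mistakeAt H (rounding s ε) e in mistake
  ... | false = +-mono-≤ (proj₁ (xe-unit e)) (proj₁ (xe-unit e))
  ... | true = subst (_≤ xe s e + xe s e) (solve 1 (λ a → (con ½ :- a) :+ (con ½ :- a) := con 1ℚ :- (a :+ a)) refl ε)
                 (+-mono-≤ ½-ε≤xe ½-ε≤xe)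
    where
    ½-ε≤xe : ½ - ε ≤ xe s e
    ½-ε≤xe = rounding-mistake⇒ H b s ε e feasible mistake

rounding-atMostOneColour : ∀ {n m k} (H : Hypergraph n m k) b s ε → LPFeasible H b s →
                           ∀ v → roundDeleted s ε v ≡ false → ∣ rounding s ε v ∣ ℕ.≤ 1
rounding-atMostOneColour H b s ε (colourSum , _ , _ , xv-unit , _) v kept with ε ≤? z s v
... | yes _ = contradiction kept λ ()
... | no _  = atMostOne-below-½ (xv s v) (colourSum v) (λ c → proj₂ (xv-unit v c))

rounding-deletions≤ : ∀ {n m k} (H : Hypergraph n m k) b s ε → LPFeasible H b s →
                      ε * ℕtoℚ (numRoundDeleted s ε) ≤ ℕtoℚ b
rounding-deletions≤ H b s ε (_ , _ , budget , _ , _ , z-unit) =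
  ≤-trans (subst (_≤ sumℚ (z s)) (sumℚ-indicator (roundDeleted s ε) ε) (sumℚ-mono-≤ charge≤z)) budget
  where
  charge≤z : ∀ v → indicator (roundDeleted s ε v) ε ≤ z s v
  charge≤z v with ε ≤? z s v
  ... | yes ε≤z = ε≤z
  ... | no _    = proj₁ (z-unit v)

theorem4p4 : ∀ {n m k : ℕ} (H : Hypergraph n m k) (b : ℕ) (s : LPSol n m k) →
    LPOptimal H b s →
    (ε : ℚ) → 0ℚ < ε → ε < ½ →
    -- mistakes(λ) ≤ (2 / (1 - 2ε)) · OPT, written multiplied out
    (∀ (μ : Coloring n k) → RobustFeasible b μ →
       (1ℚ - (ε + ε)) * ℕtoℚ (mistakes H (rounding s ε))
         ≤ (1ℚ + 1ℚ) * ℕtoℚ (mistakes H μ))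
    × (∀ (v : Fin n) → roundDeleted s ε v ≡ false →
         ∣ rounding s ε v ∣ ℕ.≤ 1)
    -- number of deleted nodes ≤ b / ε, written multiplied out
    × (ε * ℕtoℚ (numRoundDeleted s ε) ≤ ℕtoℚ b)
-- The bounds hold for every ε; 0 < ε < ½ only makes them the stated approximation ratios.
theorem4p4 H b s optimal@(feasible , _) ε _ _ =
    (λ μ μ-feasible → ≤-trans (rounding-mistakes≤ H b s ε feasible)
                        (*-monoˡ-≤-nonNeg (1ℚ + 1ℚ) (LPOptimal⇒≤mistakes H b s μ optimal μ-feasible)))
  , rounding-atMostOneColour H b s ε feasible
  , rounding-deletions≤ H b s ε feasible
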